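{- Let $\Lambda$ be a set of Sahlqvist formulas, and for each $\lambda\in\Lambda$ let $\alpha_\lambda$ be a first-order frame correspondent of $\lambda$ (a first-order sentence in the language with equality, binary predicates $\le,R$ and constant $\mathfrak{ff}$ such that for every CK-frame $\mathcal{X}$, $\mathcal{X}\Vdash\lambda$ iff $\mathcal{X}$, with $\mathfrak{ff}$ interpreted as $\text{bomb}$, satisfies $\alpha_\lambda$). Let $\mathsf{K}$ be the class of CK-frames satisfying $\alpha_\lambda$ for all $\lambda\in\Lambda$. Then the logic $\mathsf{CK}\oplus\Lambda$ is complete with respect to $\mathsf{K}$: if $\mathcal{X}\Vdash\phi$ for every $\mathcal{X}\in\mathsf{K}$, then $\phi$ is a theorem of $\mathsf{CK}\oplus\Lambda$.
   Context: Formulas: for a set $\mathrm{Prop}$ of propositional variables, $\phi::=p\mid\bot\mid\phi\wedge\phi\mid\phi\vee\phi\mid\phi\to\phi\mid\Box\phi\mid\Diamond\phi$, with $\top:=\bot\to\bot$. The logic $\mathsf{CK}$ is axiomatized by all substitution instances of the axioms of intuitionistic propositional logic together with $\Box(\phi\to\psi)\to(\Box\phi\to\Box\psi)$ and $\Box(\phi\to\psi)\to(\Diamond\phi\to\Diamond\psi)$, closed under modus ponens and necessitation (from a theorem $\phi$ infer $\Box\phi$). $\mathsf{CK}\oplus\Lambda$ additionally has all substitution instances of formulas in $\Lambda$ as axioms. A CK-frame is $(X,\text{bomb},\le,R)$ where $\le$ is a preorder on $X$, $\text{bomb}\in X$ is $\le$-maximal, and $R\subseteq X\times X$ satisfies: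 $\text{bomb}\,R\,x$ iff $x=\text{bomb}$. $\mathrm{Up}(X)$ is the set of $\le$-upsets containing $\text{bomb}$. A valuation is $V:\mathrm{Prop}\to\mathrm{Up}(X)$, extended by $V(\bot)=\{\text{bomb}\}$, $V(\wedge)=\cap$, $V(\vee)=\cup$, $V(\phi\to\psi)=\{x:\forall y(x\le y,\ y\in V(\phi)\Rightarrow y\in V(\psi))\}$, $V(\Box\phi)=\{x:\forall y,z(x\le y\,R\,z\Rightarrow z\in V(\phi))\}$, $V(\Diamond\phi)=\{x:\forall y(x\le y\Rightarrow\exists z(yRz,\ z\in V(\phi)))\}$. $\mathcal{X}\Vdash\phi$ means $V(\phi)=X$ for every valuation $V$. A formula is positive if built from variables, $\top,\bot,\wedge,\vee,\Box,\Diamond$. A boxed atom is $\Box^n p$ ($n\ge0$). A Sahlqvist antecedent is built from boxed atoms using $\top,\bot,\wedge,\vee$. A Sahlqvist formula is $\phi\to\psi$ with $\phi$ a Sahlqvist antecedent and $\psi$ positive. -}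

module Defs where

open import Data.Nat using (ℕ; zero; suc)
open import Data.Fin using (Fin) renaming (zero to fz; suc to fs)
open import Data.Product using (Σ; _×_; _,_)
open import Data.Sum using (_⊎_)
open import Data.Empty using (⊥)
open import Relation.Nullary using (¬_)
open import Relation.Binary.PropositionalEquality using (_≡_)

infixr 6 _∧'_
infixr 5 _∨'_
infixr 4 _⇒_

data Fm : Set where
  var  : ℕ → Fm
  ⊥'   : Fm
  _∧'_ : Fm → Fm → Fm
  _∨'_ : Fm → Fm → Fm
  _⇒_  : Fm → Fm → Fm
  □    : Fm → Fm
  ◇    : Fm → Fm

⊤' : Fm
⊤' = ⊥' ⇒ ⊥'

sub : (ℕ → Fm) → Fm → Fm
sub σ (var p)   = σ p
sub σ ⊥'        = ⊥'
sub σ (a ∧' b)  = sub σ a ∧' sub σ b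
sub σ (a ∨' b)  = sub σ a ∨' sub σ b
sub σ (a ⇒ b)   = sub σ a ⇒ sub σ b
sub σ (□ a)     = □ (sub σ a)
sub σ (◇ a)     = ◇ (sub σ a)

boxes : ℕ → Fm → Fm
boxes zero    φ = φ
boxes (suc n) φ = □ (boxes n φ)

data Positive : Fm → Set where
  pos-var : ∀ p → Positive (var p)
  pos-⊤   : Positive ⊤'
  pos-⊥   : Positive ⊥'
  pos-∧   : ∀ {a b} → Positive a → Positive b → Positive (a ∧' b)
  pos-∨   : ∀ {a b} → Positive a → Positive b → Positive (a ∨' b)
  pos-□   : ∀ {a} → Positive a → Positive (□ a)
  pos-◇   : ∀ {a} → Positive a → Positive (◇ a)

data BoxedAtom : Fm → Set where
  boxed : ∀ n p → BoxedAtom (boxes n (var p))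

data SahlqvistAntecedent : Fm → Set where
  sa-atom : ∀ {a} → BoxedAtom a → SahlqvistAntecedent a
  sa-⊤    : SahlqvistAntecedent ⊤'
  sa-⊥    : SahlqvistAntecedent ⊥'
  sa-∧    : ∀ {a b} → SahlqvistAntecedent a → SahlqvistAntecedent b → SahlqvistAntecedent (a ∧' b)
  sa-∨    : ∀ {a b} → SahlqvistAntecedent a → SahlqvistAntecedent b → SahlqvistAntecedent (a ∨' b)

data Sahlqvist : Fm → Set where
  sahlqvist : ∀ {a b} → SahlqvistAntecedent a → Positive b → Sahlqvist (a ⇒ b)

data Thm (Λ : Fm → Set) : Fm → Set where
  ax-K   : ∀ a b → Thm Λ (a ⇒ b ⇒ a)
  ax-S   : ∀ a b c → Thm Λ ((a ⇒ b ⇒ c) ⇒ (a ⇒ b) ⇒ a ⇒ c)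
  ax-∧₁  : ∀ a b → Thm Λ (a ∧' b ⇒ a)
  ax-∧₂  : ∀ a b → Thm Λ (a ∧' b ⇒ b)
  ax-∧I  : ∀ a b → Thm Λ (a ⇒ b ⇒ a ∧' b)
  ax-∨₁  : ∀ a b → Thm Λ (a ⇒ a ∨' b)
  ax-∨₂  : ∀ a b → Thm Λ (b ⇒ a ∨' b)
  ax-∨E  : ∀ a b c → Thm Λ ((a ⇒ c) ⇒ (b ⇒ c) ⇒ (a ∨' b ⇒ c))
  ax-⊥   : ∀ a → Thm Λ (⊥' ⇒ a)
  ax-□K  : ∀ a b → Thm Λ (□ (a ⇒ b) ⇒ □ a ⇒ □ b)
  ax-◇K  : ∀ a b → Thm Λ (□ (a ⇒ b) ⇒ ◇ a ⇒ ◇ b)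
  ax-Λ   : ∀ l → Λ l → (σ : ℕ → Fm) → Thm Λ (sub σ l)
  mp     : ∀ {a b} → Thm Λ (a ⇒ b) → Thm Λ a → Thm Λ b
  nec    : ∀ {a} → Thm Λ a → Thm Λ (□ a)

record CKFrame : Set₁ where
  field
    X        : Set
    bomb     : X
    _≤_      : X → X → Set
    ≤-refl   : ∀ x → x ≤ x
    ≤-trans  : ∀ {x y z} → x ≤ y → y ≤ z → x ≤ z
    bomb-max : ∀ {x} → bomb ≤ x → x ≡ bomb
    R        : X → X → Set
    R-bomb   : R bomb bomb
    bomb-R   : ∀ {x} → R bomb x → x ≡ bomb

module _ (F : CKFrame) where
  open CKFrame F

  record Valuation : Set₁ where
    field
      V      : ℕ → X → Set
      V-up   : ∀ p {x y} → x ≤ y → V p x → V p y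
      V-bomb : ∀ p → V p bomb

  ⟦_⟧ : Fm → (ℕ → X → Set) → X → Set
  ⟦ var p ⟧  V x = V p x
  ⟦ ⊥' ⟧     V x = x ≡ bomb
  ⟦ a ∧' b ⟧ V x = ⟦ a ⟧ V x × ⟦ b ⟧ V x
  ⟦ a ∨' b ⟧ V x = ⟦ a ⟧ V x ⊎ ⟦ b ⟧ V x
  ⟦ a ⇒ b ⟧  V x = ∀ y → x ≤ y → ⟦ a ⟧ V y → ⟦ b ⟧ V y
  ⟦ □ a ⟧    V x = ∀ y z → x ≤ y → R y z → ⟦ a ⟧ V z
  ⟦ ◇ a ⟧    V x = ∀ y → x ≤ y → Σ X (λ z → R y z × ⟦ a ⟧ V z)

_⊩_ : CKFrame → Fm → Set₁
F ⊩ φ = (v : Valuation F) → ∀ x → ⟦ F ⟧ φ (Valuation.V v) x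

data Term (n : ℕ) : Set where
  v  : Fin n → Term n
  ff : Term n

data FO : ℕ → Set where
  _≐_   : ∀ {n} → Term n → Term n → FO n
  leq   : ∀ {n} → Term n → Term n → FO n
  rel   : ∀ {n} → Term n → Term n → FO n
  fo⊥   : ∀ {n} → FO n
  fo⊤   : ∀ {n} → FO n
  fo¬   : ∀ {n} → FO n → FO n
  fo∧   : ∀ {n} → FO n → FO n → FO n
  fo∨   : ∀ {n} → FO n → FO n → FO n
  fo⇒   : ∀ {n} → FO n → FO n → FO n
  fo∀   : ∀ {n} → FO (suc n) → FO n
  fo∃   : ∀ {n} → FO (suc n) → FO n

FOSentence : Set
FOSentence = FO 0

module _ (F : CKFrame) where
  open CKFrame F

  ext : ∀ {n} → (Fin n → X) → X → Fin (suc n) → X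
  ext ρ a fz     = a
  ext ρ a (fs i) = ρ i

  evalT : ∀ {n} → (Fin n → X) → Term n → X
  evalT ρ (v i) = ρ i
  evalT ρ ff    = bomb

  Sat : ∀ {n} → (Fin n → X) → FO n → Set
  Sat ρ (s ≐ t)   = evalT ρ s ≡ evalT ρ t
  Sat ρ (leq s t) = evalT ρ s ≤ evalT ρ t
  Sat ρ (rel s t) = R (evalT ρ s) (evalT ρ t)
  Sat ρ fo⊥       = ⊥
  Sat ρ fo⊤       = ⊥ → ⊥
  Sat ρ (fo¬ a)   = ¬ Sat ρ a
  Sat ρ (fo∧ a b) = Sat ρ a × Sat ρ b
  Sat ρ (fo∨ a b) = Sat ρ a ⊎ Sat ρ b
  Sat ρ (fo⇒ a b) = Sat ρ a → Sat ρ b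
  Sat ρ (fo∀ a)   = ∀ x → Sat (ext ρ x) a
  Sat ρ (fo∃ a)   = Σ X (λ x → Sat (ext ρ x) a)

_⊨_ : CKFrame → FOSentence → Set
F ⊨ α = Sat F (λ ()) α

LEM : Set₁
LEM = (P : Set) → P ⊎ ¬ P

{-# OPTIONS --safe #-}
-- The canonical frame has as worlds the prime theories of CK ⊕ Λ, ordered by inclusion, with
-- the inconsistent theory as bomb; Lindenbaum's lemma (along an enumeration of the formulas,
-- using LEM) provides enough of them for the truth lemma, so a non-theorem fails at some world.
-- It therefore suffices that the canonical frame validates every Sahlqvist axiom A → C of Λ:
-- it then satisfies each correspondent α and lies in K.  Let V be a valuation and y a world
-- satisfying A.  Every substitution σ with □ⁿσ(p) ∈ y for the boxed atoms □ⁿp that make A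
-- true at y puts σ(A), hence σ(C), into y.  These σ are closed under conjunction, so the
-- Esakia lemma gives C at y under their intersection ⋂V; and ⋂V ⊆ V, because a boxed atom
-- true at y propagates along the R-paths that Lindenbaum's lemma builds.  As C is positive,
-- it holds at y under V.
module Submission where

open import Defs
open import Data.Bool using (Bool; T; if_then_else_)
open import Data.Empty using (⊥-elim)
open import Data.List using (List; []; _∷_; [_]; _++_)
open import Data.List.Membership.Propositional using (_∈_)
open import Data.List.Membership.Propositional.Properties using (∈-++⁺ˡ; ∈-++⁺ʳ; ∈-++⁻)
open import Data.List.Relation.Unary.Any using (here; there)
open import Data.Maybe using (Maybe; just; nothing)
open import Data.Nat using (ℕ; zero; suc; _+_; _≤_; _⊔_; s≤s; _≤′_; ≤′-refl; ≤′-step; _≟_)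
open import Data.Nat.Properties
  using (+-suc; +-identityʳ; suc-injective; ≤-refl; ≤-trans; m≤m⊔n; m≤n⊔m; ≤⇒≤′; ≟-diag)
open import Data.Product using (Σ; ∃; ∃-syntax; ∃₂; _×_; _,_; proj₁; proj₂; uncurry)
open import Data.Sum as Sum using (_⊎_; inj₁; inj₂; [_,_]′)
open import Data.Unit using (⊤; tt)
open import Function using (id; _∘_)
open import Level using (0ℓ)
open import Relation.Binary.PropositionalEquality using (_≡_; refl; sym; trans; cong; cong₂; subst)
open import Relation.Nullary using (¬_; Dec; yes; no)
open import Relation.Nullary.Decidable using (fromSum; decidable-stable; ⌊_⌋; toWitness; fromWitness)
open import Relation.Unary using (Pred; _⊆_; _∪_; ｛_｝; ∅; U; ⋃)

variable
  a b c φ ψ χ : Fm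
  m n p : ℕ
  Γ Δ P : Pred Fm 0ℓ

-- Enumerating formulas

next : ℕ × ℕ → ℕ × ℕ
next (zero  , j) = suc j , zero
next (suc i , j) = i , suc j

unpair : ℕ → ℕ × ℕ
unpair zero    = zero , zero
unpair (suc n) = next (unpair n)

unpair-surjective : ∀ i j → ∃[ n ] unpair n ≡ (i , j)
unpair-surjective i j = along (i + j) i j refl
  where
  after : ∀ {i j} → ∃[ n ] unpair n ≡ (i , j) → ∃[ n ] unpair n ≡ next (i , j)
  after (n , eq) = suc n , cong next eq

  along : ∀ d i j → i + j ≡ d → ∃[ n ] unpair n ≡ (i , j)
  along d       i       (suc j) eq = after (along d (suc i) j (trans (sym (+-suc i j)) eq))
  along zero    zero    zero    _  = zero , refl
  along (suc d) (suc i) zero    eq =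
    after (along d zero i (trans (sym (+-identityʳ i)) (suc-injective eq)))
  along zero    (suc _) zero    ()
  along (suc _) zero    zero    ()

pair : ℕ → ℕ → ℕ
pair i j = proj₁ (unpair-surjective i j)

unpair-pair : ∀ i j → unpair (pair i j) ≡ (i , j)
unpair-pair i j = proj₂ (unpair-surjective i j)

binary : ℕ → Fm → Fm → Fm
binary 0 = _∧'_
binary 1 = _∨'_
binary _ = _⇒_

node : (ℕ → Fm) → ℕ → ℕ → Fm
node d 0 m = var m
node d 1 m = ⊥'
node d 2 m = □ (d m)
node d 3 m = ◇ (d m)
node d (suc (suc (suc (suc k)))) m = binary k (d (proj₁ (unpair m))) (d (proj₂ (unpair m)))

-- A code n is read as (tag , m) = unpair n, binary nodes reading m as a pair of child codes;
-- the fuel f keeps the recursion structural.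
decode : ℕ → ℕ → Fm
decode zero    _ = ⊥'
decode (suc f) n = uncurry (node (decode f)) (unpair n)

Encoding : Fm → Set
Encoding φ = ∃₂ λ f n → ∀ {g} → f ≤ g → decode g n ≡ φ

encode-node : ∀ k m f → (∀ {g} → f ≤ g → node (decode g) k m ≡ φ) → Encoding φ
encode-node k m f h =
  suc f , pair k m , λ { (s≤s f≤g) → trans (cong (uncurry (node _)) (unpair-pair k m)) (h f≤g) }

encode-binary : ∀ k → Encoding a → Encoding b → Encoding (binary k a b)
encode-binary k (fa , na , ha) (fb , nb , hb) = encode-node (4 + k) (pair na nb) (fa ⊔ fb) decodes
  where
  decodes : ∀ {g} → fa ⊔ fb ≤ g → node (decode g) (4 + k) (pair na nb) ≡ binary k _ _
  decodes le rewrite unpair-pair na nb =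
    cong₂ (binary k) (ha (≤-trans (m≤m⊔n fa fb) le)) (hb (≤-trans (m≤n⊔m fa fb) le))

encode : ∀ φ → Encoding φ
encode (var p)  = encode-node 0 p 0 λ _ → refl
encode ⊥'       = encode-node 1 0 0 λ _ → refl
encode (a ∧' b) = encode-binary 0 (encode a) (encode b)
encode (a ∨' b) = encode-binary 1 (encode a) (encode b)
encode (a ⇒ b)  = encode-binary 2 (encode a) (encode b)
encode (□ a) with encode a
... | f , n , h = encode-node 2 n f (cong □ ∘ h)
encode (◇ a) with encode a
... | f , n , h = encode-node 3 n f (cong ◇ ∘ h)

enumerate : ℕ → Fm
enumerate = uncurry decode ∘ unpair

enumerate-surjective : ∀ φ → ∃[ n ] enumerate n ≡ φ
enumerate-surjective φ with encode φ
... | f , n , h = pair f n , trans (cong (uncurry decode) (unpair-pair f n)) (h ≤-refl)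

Subst : Set
Subst = ℕ → Fm

_∧ˢ_ : Subst → Subst → Subst
(σ ∧ˢ τ) p = σ p ∧' τ p

⊤ˢ : Subst
⊤ˢ _ = ⊤'

sub-boxes : ∀ (σ : Subst) n φ → sub σ (boxes n φ) ≡ boxes n (sub σ φ)
sub-boxes σ zero    φ = refl
sub-boxes σ (suc n) φ = cong □ (sub-boxes σ n φ)

⟦⟧-mono : ∀ (F : CKFrame) {V V′ : ℕ → CKFrame.X F → Set} → (∀ {p x} → V p x → V′ p x) →
          Positive φ → ∀ x → ⟦ F ⟧ φ V x → ⟦ F ⟧ φ V′ x
⟦⟧-mono F V⊆V′ (pos-var p)   x s              = V⊆V′ s
⟦⟧-mono F V⊆V′ pos-⊤         x s              = s
⟦⟧-mono F V⊆V′ pos-⊥         x s              = s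
⟦⟧-mono F V⊆V′ (pos-∧ pa pb) x (sa , sb)      = ⟦⟧-mono F V⊆V′ pa x sa , ⟦⟧-mono F V⊆V′ pb x sb
⟦⟧-mono F V⊆V′ (pos-∨ pa pb) x s              = Sum.map (⟦⟧-mono F V⊆V′ pa x) (⟦⟧-mono F V⊆V′ pb x) s
⟦⟧-mono F V⊆V′ (pos-□ pa)    x s y z x≤y yRz  = ⟦⟧-mono F V⊆V′ pa z (s y z x≤y yRz)
⟦⟧-mono F V⊆V′ (pos-◇ pa)    x s y x≤y with s y x≤y
... | z , yRz , sz = z , yRz , ⟦⟧-mono F V⊆V′ pa z sz

module Derivations (Λ : Fm → Set) where

  infix 3 _⊢_
  infixl 5 _·_

  data _⊢_ (Γ : Pred Fm 0ℓ) : Fm → Set where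
    hyp : Γ φ → Γ ⊢ φ
    thm : Thm Λ φ → Γ ⊢ φ
    app : Γ ⊢ φ ⇒ ψ → Γ ⊢ φ → Γ ⊢ ψ

  _·_ : Thm Λ (φ ⇒ ψ) → Γ ⊢ φ → Γ ⊢ ψ
  t · d = app (thm t) d

  ⇒-refl : Thm Λ (φ ⇒ φ)
  ⇒-refl {φ} = mp (mp (ax-S φ (φ ⇒ φ) φ) (ax-K φ (φ ⇒ φ))) (ax-K φ φ)

  weaken : Γ ⊆ Δ → Γ ⊢ φ → Δ ⊢ φ
  weaken Γ⊆Δ (hyp γ)   = hyp (Γ⊆Δ γ)
  weaken Γ⊆Δ (thm t)   = thm t
  weaken Γ⊆Δ (app d e) = app (weaken Γ⊆Δ d) (weaken Γ⊆Δ e)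

  deduction : Γ ∪ ｛ φ ｝ ⊢ ψ → Γ ⊢ φ ⇒ ψ
  deduction (hyp (inj₁ γ))    = ax-K _ _ · hyp γ
  deduction (hyp (inj₂ refl)) = thm ⇒-refl
  deduction (thm t)           = ax-K _ _ · thm t
  deduction (app d e)         = app (ax-S _ _ _ · deduction d) (deduction e)

  cut : Γ ⊢ φ → Γ ∪ ｛ φ ｝ ⊢ ψ → Γ ⊢ ψ
  cut d e = app (deduction e) d

  strengthen : Thm Λ (b ⇒ a) → Γ ∪ ｛ a ｝ ⊢ φ → Γ ∪ ｛ b ｝ ⊢ φ
  strengthen t d = app (weaken inj₁ (deduction d)) (t · hyp (inj₂ refl))

  ∅⊢⇒Thm : ∅ ⊢ φ → Thm Λ φ
  ∅⊢⇒Thm (thm t)   = t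
  ∅⊢⇒Thm (app d e) = mp (∅⊢⇒Thm d) (∅⊢⇒Thm e)

  ⇒-intro : ｛ φ ｝ ⊢ ψ → Thm Λ (φ ⇒ ψ)
  ⇒-intro d = ∅⊢⇒Thm (deduction (weaken inj₂ d))

  ∧-intro : Γ ⊢ φ → Γ ⊢ ψ → Γ ⊢ φ ∧' ψ
  ∧-intro d e = app (ax-∧I _ _ · d) e

  ∨-elim : Γ ⊢ a ∨' b → Γ ∪ ｛ a ｝ ⊢ c → Γ ∪ ｛ b ｝ ⊢ c → Γ ⊢ c
  ∨-elim d e f = app (app (ax-∨E _ _ _ · deduction e) (deduction f)) d

  ⇒-trans : Thm Λ (a ⇒ b) → Thm Λ (b ⇒ c) → Thm Λ (a ⇒ c)
  ⇒-trans s t = ⇒-intro (t · (s · hyp refl))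

  ⇒-∨ : Thm Λ (a ⇒ c) → Thm Λ (b ⇒ c) → Thm Λ (a ∨' b ⇒ c)
  ⇒-∨ s t = mp (mp (ax-∨E _ _ _) s) t

  □-mono : Thm Λ (a ⇒ b) → Thm Λ (□ a ⇒ □ b)
  □-mono t = mp (ax-□K _ _) (nec t)

  ◇-mono : Thm Λ (a ⇒ b) → Thm Λ (◇ a ⇒ ◇ b)
  ◇-mono t = mp (ax-◇K _ _) (nec t)

  boxes-mono : ∀ n → Thm Λ (a ⇒ b) → Thm Λ (boxes n a ⇒ boxes n b)
  boxes-mono zero    t = t
  boxes-mono (suc n) t = □-mono (boxes-mono n t)

  sub-mono : ∀ {σ τ : Subst} → Positive φ → (∀ p → Thm Λ (σ p ⇒ τ p)) → Thm Λ (sub σ φ ⇒ sub τ φ)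
  sub-mono (pos-var p)   h = h p
  sub-mono pos-⊤         h = ⇒-refl
  sub-mono pos-⊥         h = ⇒-refl
  sub-mono (pos-∧ pa pb) h =
    ⇒-intro (∧-intro (sub-mono pa h · (ax-∧₁ _ _ · hyp refl)) (sub-mono pb h · (ax-∧₂ _ _ · hyp refl)))
  sub-mono (pos-∨ pa pb) h =
    ⇒-∨ (⇒-trans (sub-mono pa h) (ax-∨₁ _ _)) (⇒-trans (sub-mono pb h) (ax-∨₂ _ _))
  sub-mono (pos-□ pa)    h = □-mono (sub-mono pa h)
  sub-mono (pos-◇ pa)    h = ◇-mono (sub-mono pa h)

  □⁻¹ : Pred Fm 0ℓ → Pred Fm 0ℓ
  □⁻¹ Γ φ = Γ (□ φ)

  boxes⁻¹ : ℕ → Pred Fm 0ℓ → Pred Fm 0ℓ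
  boxes⁻¹ n Γ φ = Γ (boxes n φ)

  □-lift : □⁻¹ Γ ⊢ φ → Γ ⊢ □ φ
  □-lift (hyp γ)   = hyp γ
  □-lift (thm t)   = thm (nec t)
  □-lift (app d e) = app (ax-□K _ _ · □-lift d) (□-lift e)

  ◇-lift : □⁻¹ Γ ∪ ｛ a ｝ ⊢ b → Γ ⊢ ◇ a ⇒ ◇ b
  ◇-lift d = ax-◇K _ _ · □-lift (deduction d)

  Closed : Pred Fm 0ℓ → Set
  Closed Γ = ∀ {φ} → Γ ⊢ φ → Γ φ

  Prime : Pred Fm 0ℓ → Set
  Prime Γ = ∀ {φ ψ} → Γ (φ ∨' ψ) → Γ φ ⊎ Γ ψ

  boxes⁻¹-closed : ∀ n → Closed Γ → Closed (boxes⁻¹ n Γ)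
  boxes⁻¹-closed zero    closed = closed
  boxes⁻¹-closed (suc n) closed = boxes⁻¹-closed n (closed ∘ □-lift)

  Avoids : Pred Fm 0ℓ → Pred Fm 0ℓ → Set
  Avoids Γ B = ∀ {χ} → Γ ⊢ χ → ¬ B χ

  ⊢-⋃-compact : {Γ : ℕ → Pred Fm 0ℓ} → (∀ n → Γ n ⊆ Γ (suc n)) → ⋃ ℕ Γ ⊢ φ → ∃[ n ] Γ n ⊢ φ
  ⊢-⋃-compact {Γ = Γ} step = compact
    where
    chain : m ≤′ n → Γ m ⊆ Γ n
    chain ≤′-refl       = id
    chain (≤′-step m≤n) = step _ ∘ chain m≤n

    raise : m ≤ n → Γ m ⊢ φ → Γ n ⊢ φ
    raise m≤n = weaken (chain (≤⇒≤′ m≤n))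

    compact : ⋃ ℕ Γ ⊢ φ → ∃[ n ] Γ n ⊢ φ
    compact (hyp (n , γ)) = n , hyp γ
    compact (thm t)       = 0 , thm t
    compact (app d e) with compact d | compact e
    ... | m , d′ | n , e′ = m ⊔ n , app (raise (m≤m⊔n m n) d′) (raise (m≤n⊔m m n) e′)

  Directed : Pred Fm 0ℓ → Set
  Directed P = ∃ P × (∀ {a b} → P a → P b → ∃[ c ] P c × Thm Λ (c ⇒ a) × Thm Λ (c ⇒ b))

  ⊢-directed-compact : Directed P → Γ ∪ P ⊢ φ → ∃[ c ] P c × Γ ∪ ｛ c ｝ ⊢ φ
  ⊢-directed-compact ((c , Pc) , _) (hyp (inj₁ γ)) = c , Pc , hyp (inj₁ γ)
  ⊢-directed-compact _              (hyp (inj₂ Pφ)) = _ , Pφ , hyp (inj₂ refl)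
  ⊢-directed-compact ((c , Pc) , _) (thm t)         = c , Pc , thm t
  ⊢-directed-compact dir@(_ , meet) (app d e) with ⊢-directed-compact dir d | ⊢-directed-compact dir e
  ... | a , Pa , d′ | b , Pb , e′ with meet Pa Pb
  ... | c , Pc , c⇒a , c⇒b = c , Pc , app (strengthen c⇒a d′) (strengthen c⇒b e′)

module Canonical (lem : LEM) (Λ : Fm → Set) where
  open Derivations Λ

  decide : (A : Set) → Dec A
  decide A = fromSum (lem A)

  dne : {A : Set} → ¬ ¬ A → A
  dne = decidable-stable (decide _)

  -- Prime theories and Lindenbaum's lemma

  -- Worlds must form a small type, so a theory is stored by its characteristic function,
  -- which reify computes with LEM.
  record PrimeTheory : Set where
    field
      member     : Fm → Bool
      closed     : Closed (T ∘ member)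
      prime      : Prime (T ∘ member)
      consistent : ¬ T (member ⊥')
  open PrimeTheory

  infix 4 _∋_
  _∋_ : PrimeTheory → Fm → Set
  Δ ∋ φ = T (member Δ φ)

  reify : Closed Γ → Prime Γ → ¬ Γ ⊥' → Σ PrimeTheory λ Δ → Γ ⊆ (Δ ∋_) × (Δ ∋_) ⊆ Γ
  reify {Γ} closed prime consistent =
    record
      { member     = λ φ → ⌊ decide (Γ φ) ⌋
      ; closed     = λ d → fromWitness (closed (weaken toWitness d))
      ; prime      = Sum.map fromWitness fromWitness ∘ prime ∘ toWitness
      ; consistent = consistent ∘ toWitness
      } , fromWitness , toWitness

  module Lindenbaum (S B : Pred Fm 0ℓ) (B-∨ : ∀ {a b} → B a → B b → B (a ∨' b)) (B-⊥ : B ⊥')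
                    (S-avoids : Avoids S B) where

    stage : ℕ → Pred Fm 0ℓ
    stage zero      = S
    stage (suc n) ψ = stage n ψ ⊎ (enumerate n ≡ ψ × Avoids (stage n ∪ ｛ enumerate n ｝) B)

    stage-avoids : ∀ n → Avoids (stage n) B
    stage-avoids zero = S-avoids
    stage-avoids (suc n) with decide (Avoids (stage n ∪ ｛ enumerate n ｝) B)
    ... | yes avoids = λ d → avoids (weaken (Sum.map₂ proj₁) d)
    ... | no ¬avoids = λ d → stage-avoids n (weaken [ id , ⊥-elim ∘ ¬avoids ∘ proj₂ ]′ d)

    limit : Pred Fm 0ℓ
    limit = ⋃ ℕ stage

    limit-avoids : Avoids limit B
    limit-avoids d = let n , dₙ = ⊢-⋃-compact (λ _ → inj₁) d in stage-avoids n dₙ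

    outside-conflicts : ¬ limit φ → ¬ Avoids (limit ∪ ｛ φ ｝) B
    outside-conflicts {φ} φ∉ avoids with enumerate-surjective φ
    ... | n , refl = φ∉ (suc n , inj₂ (refl , λ d → avoids (weaken (Sum.map₁ (n ,_)) d)))

    conflict : ¬ Avoids Γ B → ∃[ χ ] Γ ⊢ χ × B χ
    conflict ¬avoids = dne λ none → ¬avoids λ d b → none (_ , d , b)

    limit-closed : Closed limit
    limit-closed d = dne λ φ∉ → outside-conflicts φ∉ λ e → limit-avoids (cut d e)

    limit-prime : Prime limit
    limit-prime a∨b = dne λ neither →
      let _ , da , Ba = conflict (outside-conflicts (neither ∘ inj₁))
          _ , db , Bb = conflict (outside-conflicts (neither ∘ inj₂))
      in limit-avoids (∨-elim (hyp a∨b) (ax-∨₁ _ _ · da) (ax-∨₂ _ _ · db)) (B-∨ Ba Bb)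

    limit-consistent : ¬ limit ⊥'
    limit-consistent m = limit-avoids (hyp m) B-⊥

  lindenbaum : (S B : Pred Fm 0ℓ) → (∀ {a b} → B a → B b → B (a ∨' b)) → B ⊥' → Avoids S B →
               Σ PrimeTheory λ Δ → S ⊆ (Δ ∋_) × Avoids (Δ ∋_) B
  lindenbaum S B B-∨ B-⊥ S-avoids =
    let Δ , limit⊆Δ , Δ⊆limit = reify limit-closed limit-prime limit-consistent
    in Δ , (λ s → limit⊆Δ (0 , s)) , λ d → limit-avoids (weaken Δ⊆limit d)
    where open Lindenbaum S B B-∨ B-⊥ S-avoids

  extend-avoiding : (S : Pred Fm 0ℓ) (ν : Fm) → ¬ (S ⊢ ν) → Σ PrimeTheory λ Δ → S ⊆ (Δ ∋_) × ¬ Δ ∋ ν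
  extend-avoiding S ν S⊬ν =
    let Δ , S⊆Δ , avoids = lindenbaum S (λ χ → Thm Λ (χ ⇒ ν)) ⇒-∨ (ax-⊥ ν) (λ d t → S⊬ν (t · d))
    in Δ , S⊆Δ , λ ν∈Δ → avoids (hyp ν∈Δ) ⇒-refl

  -- The canonical frame

  -- Besides bomb, a world is a prime theory Γ with at most one formula ν such that ◇ν ∉ Γ,
  -- which all its R-successors must refute; these ν make the truth lemma hold for ◇.
  data World : Set where
    bomb  : World
    world : (Γ : PrimeTheory) → Maybe (∃ λ ν → ¬ Γ ∋ ◇ ν) → World

  mem : World → Pred Fm 0ℓ
  mem bomb        = U
  mem (world Γ _) = Γ ∋_

  mem-closed : ∀ x → Closed (mem x)
  mem-closed bomb        _ = tt
  mem-closed (world Γ _)   = closed Γ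

  mem-prime : ∀ x → Prime (mem x)
  mem-prime bomb        _ = inj₁ tt
  mem-prime (world Γ _)   = prime Γ

  ⊥∈⇒bomb : ∀ x → mem x ⊥' → x ≡ bomb
  ⊥∈⇒bomb bomb        _   = refl
  ⊥∈⇒bomb (world Γ _) ⊥∈Γ = ⊥-elim (consistent Γ ⊥∈Γ)

  _⊑_ : World → World → Set
  x ⊑ y = mem x ⊆ mem y

  Refutes : World → World → Set
  Refutes (world _ (just (ν , _))) z = ¬ mem z ν
  Refutes _                        _ = ⊤

  _R_ : World → World → Set
  x R z = □⁻¹ (mem x) ⊆ mem z × Refutes x z

  canonicalFrame : CKFrame
  canonicalFrame = record
    { X        = World
    ; bomb     = bomb
    ; _≤_      = _⊑_
    ; ≤-refl   = λ _ → id
    ; ≤-trans  = λ x⊑y y⊑z → y⊑z ∘ x⊑y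
    ; bomb-max = λ {x} bomb⊑x → ⊥∈⇒bomb x (bomb⊑x tt)
    ; R        = _R_
    ; R-bomb   = (λ _ → tt) , tt
    ; bomb-R   = λ {x} bombRx → ⊥∈⇒bomb x (proj₁ bombRx tt)
    }

  ⟦_⟧ᶜ : Fm → (ℕ → World → Set) → World → Set
  ⟦_⟧ᶜ = ⟦ canonicalFrame ⟧

  ◇-successor : ∀ y → Directed P → (∀ {c} → P c → mem y (◇ c)) → ∃[ z ] y R z × P ⊆ mem z
  ◇-successor bomb                   _   _  = bomb , ((λ _ → tt) , tt) , λ _ → tt
  ◇-successor (world Γ nothing)      _   _  = bomb , ((λ _ → tt) , tt) , λ _ → tt
  ◇-successor {P} (world Γ (just (ν , ◇ν∉Γ))) dir ◇P =
    let Δ , ⊆Δ , ν∉Δ = extend-avoiding (□⁻¹ (Γ ∋_) ∪ P) ν ⊬ν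
    in world Δ nothing , ((⊆Δ ∘ inj₁) , ν∉Δ) , ⊆Δ ∘ inj₂
    where
    ⊬ν : ¬ (□⁻¹ (Γ ∋_) ∪ P ⊢ ν)
    ⊬ν d = let c , Pc , d′ = ⊢-directed-compact dir d in ◇ν∉Γ (closed Γ (app (◇-lift d′) (hyp (◇P Pc))))

  ｛｝-directed : Directed ｛ a ｝
  ｛｝-directed = (_ , refl) , λ { refl refl → _ , refl , ⇒-refl , ⇒-refl }

  Vᶜ : ℕ → World → Set
  Vᶜ p x = mem x (var p)

  canonicalValuation : Valuation canonicalFrame
  canonicalValuation = record { V = Vᶜ ; V-up = λ _ x⊑y → x⊑y ; V-bomb = λ _ → tt }

  truth⁺ : ∀ φ x → mem x φ → ⟦ φ ⟧ᶜ Vᶜ x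
  truth⁻ : ∀ φ x → ⟦ φ ⟧ᶜ Vᶜ x → mem x φ

  truth⁺ (var p)  x m = m
  truth⁺ ⊥'       x m = ⊥∈⇒bomb x m
  truth⁺ (a ∧' b) x m =
    truth⁺ a x (mem-closed x (ax-∧₁ _ _ · hyp m)) , truth⁺ b x (mem-closed x (ax-∧₂ _ _ · hyp m))
  truth⁺ (a ∨' b) x m = Sum.map (truth⁺ a x) (truth⁺ b x) (mem-prime x m)
  truth⁺ (a ⇒ b)  x m y x⊑y sa = truth⁺ b y (mem-closed y (app (hyp (x⊑y m)) (hyp (truth⁻ a y sa))))
  truth⁺ (□ a)    x m y z x⊑y (□y⊆z , _) = truth⁺ a z (□y⊆z (x⊑y m))
  truth⁺ (◇ a)    x m y x⊑y =
    let z , yRz , a∈z = ◇-successor y ｛｝-directed λ { refl → x⊑y m } in z , yRz , truth⁺ a z (a∈z refl)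

  truth⁻ (var p)  x s = s
  truth⁻ ⊥'       x refl = tt
  truth⁻ (a ∧' b) x (sa , sb) = mem-closed x (∧-intro (hyp (truth⁻ a x sa)) (hyp (truth⁻ b x sb)))
  truth⁻ (a ∨' b) x (inj₁ sa) = mem-closed x (ax-∨₁ _ _ · hyp (truth⁻ a x sa))
  truth⁻ (a ∨' b) x (inj₂ sb) = mem-closed x (ax-∨₂ _ _ · hyp (truth⁻ b x sb))
  truth⁻ (a ⇒ b)  bomb        s = tt
  truth⁻ (a ⇒ b)  (world Γ _) s = dne λ a⇒b∉Γ →
    let Δ , Γa⊆Δ , b∉Δ = extend-avoiding ((Γ ∋_) ∪ ｛ a ｝) b (a⇒b∉Γ ∘ closed Γ ∘ deduction)
        Δ⊨a = truth⁺ a (world Δ nothing) (Γa⊆Δ (inj₂ refl))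
    in b∉Δ (truth⁻ b (world Δ nothing) (s (world Δ nothing) (Γa⊆Δ ∘ inj₁) Δ⊨a))
  truth⁻ (□ a)    bomb        s = tt
  truth⁻ (□ a)    (world Γ _) s = dne λ □a∉Γ →
    let Δ , □Γ⊆Δ , a∉Δ = extend-avoiding (□⁻¹ (Γ ∋_)) a (□a∉Γ ∘ closed Γ ∘ □-lift)
    in a∉Δ (truth⁻ a (world Δ nothing) (s (world Γ nothing) (world Δ nothing) id (□Γ⊆Δ , tt)))
  truth⁻ (◇ a)    bomb        s = tt
  truth⁻ (◇ a)    (world Γ _) s = dne λ ◇a∉Γ →
    let z , (_ , a∉z) , sa = s (world Γ (just (a , ◇a∉Γ))) id in a∉z (truth⁻ a z sa)

  -- Canonicity of Sahlqvist formulas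

  ⋂V : Pred Subst 0ℓ → ℕ → World → Set
  ⋂V Adm p z = ∀ {σ} → Adm σ → mem z (σ p)

  module _ (Adm : Pred Subst 0ℓ) (adm-⊤ : Adm ⊤ˢ) (adm-∧ : ∀ {σ τ} → Adm σ → Adm τ → Adm (σ ∧ˢ τ)) where

    image-directed : Positive a → Directed (λ c → ∃[ σ ] Adm σ × sub σ a ≡ c)
    image-directed pa =
      (_ , ⊤ˢ , adm-⊤ , refl) ,
      λ { (σ , admσ , refl) (τ , admτ , refl) →
            _ , (σ ∧ˢ τ , adm-∧ admσ admτ , refl) ,
            sub-mono pa (λ _ → ax-∧₁ _ _) , sub-mono pa (λ _ → ax-∧₂ _ _) }

    esakia : Positive φ → ∀ z → (∀ {σ} → Adm σ → mem z (sub σ φ)) → ⟦ φ ⟧ᶜ (⋂V Adm) z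
    esakia (pos-var p)   z h = h
    esakia pos-⊤         z h _ _ m = m
    esakia pos-⊥         z h = ⊥∈⇒bomb z (h adm-⊤)
    esakia (pos-∧ pa pb) z h =
      esakia pa z (λ adm → mem-closed z (ax-∧₁ _ _ · hyp (h adm))) ,
      esakia pb z (λ adm → mem-closed z (ax-∧₂ _ _ · hyp (h adm)))
    esakia (pos-∨ {a} {b} pa pb) z h with decide (∃[ σ ] Adm σ × ¬ mem z (sub σ a))
    ... | no none = inj₁ (esakia pa z λ adm → dne λ ∉ → none (_ , adm , ∉))
    ... | yes (σ₁ , adm₁ , a₁∉z) = inj₂ (esakia pb z λ adm → right (mem-prime z (h (adm-∧ adm adm₁))))
      where
      right : ∀ {σ} → mem z (sub (σ ∧ˢ σ₁) a) ⊎ mem z (sub (σ ∧ˢ σ₁) b) → mem z (sub σ b)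
      right (inj₁ a∈z) = ⊥-elim (a₁∉z (mem-closed z (sub-mono pa (λ _ → ax-∧₂ _ _) · hyp a∈z)))
      right (inj₂ b∈z) = mem-closed z (sub-mono pb (λ _ → ax-∧₁ _ _) · hyp b∈z)
    esakia (pos-□ pa)    z h y w z⊑y (□y⊆w , _) = esakia pa w λ adm → □y⊆w (z⊑y (h adm))
    esakia (pos-◇ pa)    z h y z⊑y =
      let w , yRw , image⊆w = ◇-successor y (image-directed pa) λ { (_ , adm , refl) → z⊑y (h adm) }
      in w , yRw , esakia pa w λ adm → image⊆w (_ , adm , refl)

  Admissible : World → List (ℕ × ℕ) → Pred Subst 0ℓ
  Admissible y Ls σ = ∀ {n p} → (n , p) ∈ Ls → mem y (boxes n (σ p))

  admissible-⊤ : ∀ y Ls → Admissible y Ls ⊤ˢ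
  admissible-⊤ y Ls {n} _ = boxes⁻¹-closed n (mem-closed y) (thm ⇒-refl)

  admissible-∧ : ∀ {y Ls σ τ} → Admissible y Ls σ → Admissible y Ls τ → Admissible y Ls (σ ∧ˢ τ)
  admissible-∧ {y} admσ admτ {n} e =
    boxes⁻¹-closed n (mem-closed y) (∧-intro (hyp (admσ e)) (hyp (admτ e)))

  only : ℕ → Fm → Subst
  only p D q = if ⌊ q ≟ p ⌋ then D else ⊤'

  only-self : ∀ p D → only p D p ≡ D
  only-self p D rewrite ≟-diag (refl {x = p}) = refl

  only-admissible : ∀ {y D} Ls → (∀ {n} → (n , p) ∈ Ls → mem y (boxes n D)) → Admissible y Ls (only p D)
  only-admissible {p} {y} Ls h {p = q} e with q ≟ p
  ... | yes refl = h e
  ... | no _     = admissible-⊤ y Ls e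

  common-refutation : ∀ {y} (Δ : PrimeTheory) p Ls →
    (∀ {n} → (n , p) ∈ Ls → ∃[ ψ ] mem y (boxes n ψ) × ¬ Δ ∋ ψ) →
    ∃[ D ] (∀ {n} → (n , p) ∈ Ls → mem y (boxes n D)) × ¬ Δ ∋ D
  common-refutation Δ p [] _ = ⊥' , (λ ()) , consistent Δ
  common-refutation {y} Δ p ((m , q) ∷ Ls) refute
    with common-refutation {y} Δ p Ls (refute ∘ there) | q ≟ p
  ... | D , □D∈y , D∉Δ | no q≢p =
    D , (λ { (here refl) → ⊥-elim (q≢p refl) ; (there e) → □D∈y e }) , D∉Δ
  ... | D , □D∈y , D∉Δ | yes refl =
    let ψ , □ψ∈y , ψ∉Δ = refute (here refl)
        weakened : ∀ {n χ} → Thm Λ (χ ⇒ ψ ∨' D) → mem y (boxes n χ) → mem y (boxes n (ψ ∨' D))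
        weakened {n} t □χ∈y = boxes⁻¹-closed n (mem-closed y) (t · hyp □χ∈y)
    in ψ ∨' D ,
       (λ { (here refl) → weakened (ax-∨₁ _ _) □ψ∈y ; (there e) → weakened (ax-∨₂ _ _) (□D∈y e) }) ,
       [ ψ∉Δ , D∉Δ ]′ ∘ prime Δ

  boxes⁻¹-factor : ∀ n (Γ Δ : PrimeTheory) → boxes⁻¹ (suc n) (Γ ∋_) ⊆ (Δ ∋_) →
                   Σ PrimeTheory λ Θ → □⁻¹ (Γ ∋_) ⊆ (Θ ∋_) × boxes⁻¹ n (Θ ∋_) ⊆ (Δ ∋_)
  boxes⁻¹-factor n Γ Δ □ⁿ⁺¹Γ⊆Δ =
    let Θ , □Γ⊆Θ , avoids =
          lindenbaum (□⁻¹ (Γ ∋_)) BoxesOutside join (⊥' , consistent Δ , ax-⊥ _) □Γ-avoids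
    in Θ , □Γ⊆Θ , λ □ⁿψ∈Θ → dne λ ψ∉Δ → avoids (hyp □ⁿψ∈Θ) (_ , ψ∉Δ , ⇒-refl)
    where
    BoxesOutside : Pred Fm 0ℓ
    BoxesOutside χ = ∃[ ψ ] ¬ Δ ∋ ψ × Thm Λ (χ ⇒ boxes n ψ)

    join : BoxesOutside a → BoxesOutside b → BoxesOutside (a ∨' b)
    join (ψ₁ , ψ₁∉Δ , t₁) (ψ₂ , ψ₂∉Δ , t₂) =
      ψ₁ ∨' ψ₂ , [ ψ₁∉Δ , ψ₂∉Δ ]′ ∘ prime Δ ,
      ⇒-∨ (⇒-trans t₁ (boxes-mono n (ax-∨₁ _ _))) (⇒-trans t₂ (boxes-mono n (ax-∨₂ _ _)))

    □Γ-avoids : Avoids (□⁻¹ (Γ ∋_)) BoxesOutside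
    □Γ-avoids d (ψ , ψ∉Δ , t) = ψ∉Δ (□ⁿ⁺¹Γ⊆Δ (closed Γ (□-lift (t · d))))

  module _ (val : Valuation canonicalFrame) where
    open Valuation val

    boxed-atom-transfer : ∀ n {x z} → ⟦ boxes n (var p) ⟧ᶜ V x → boxes⁻¹ n (mem x) ⊆ mem z → V p z
    boxed-atom-transfer zero    s x⊑z = V-up _ x⊑z s
    boxed-atom-transfer (suc n) {z = bomb} _ _ = V-bomb _
    boxed-atom-transfer (suc n) {bomb} {world Δ _} _ □ⁿ⁺¹x⊆Δ = ⊥-elim (consistent Δ (□ⁿ⁺¹x⊆Δ tt))
    boxed-atom-transfer (suc n) {world Γ _} {world Δ _} s □ⁿ⁺¹Γ⊆Δ =
      let Θ , □Γ⊆Θ , □ⁿΘ⊆Δ = boxes⁻¹-factor n Γ Δ □ⁿ⁺¹Γ⊆Δ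
      in boxed-atom-transfer n (s (world Γ nothing) (world Θ nothing) id (□Γ⊆Θ , tt)) □ⁿΘ⊆Δ

    boxed-atom-refuted : ∀ n {x z} → ⟦ boxes n (var p) ⟧ᶜ V x → ¬ V p z →
                         ∃[ ψ ] mem x (boxes n ψ) × ¬ mem z ψ
    boxed-atom-refuted n s ¬Vz = dne λ none →
      ¬Vz (boxed-atom-transfer n s λ □ⁿψ∈x → dne λ ψ∉z → none (_ , □ⁿψ∈x , ψ∉z))

    BoxedAtomsHold : World → List (ℕ × ℕ) → Set
    BoxedAtomsHold y Ls = ∀ {n p} → (n , p) ∈ Ls → ⟦ boxes n (var p) ⟧ᶜ V y

    antecedent-witness : ∀ {y} → SahlqvistAntecedent φ → ⟦ φ ⟧ᶜ V y →
      ∃[ Ls ] BoxedAtomsHold y Ls × (∀ {σ} → Admissible y Ls σ → mem y (sub σ φ))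
    antecedent-witness {y = y} (sa-atom (boxed n p)) s =
      [ n , p ] , (λ { (here refl) → s }) ,
      λ {σ} adm → subst (mem y) (sym (sub-boxes σ n (var p))) (adm (here refl))
    antecedent-witness {y = y} sa-⊤ s = [] , (λ ()) , λ _ → mem-closed y (thm ⇒-refl)
    antecedent-witness sa-⊥ refl = [] , (λ ()) , λ _ → tt
    antecedent-witness {y = y} (sa-∧ sa sb) (sa′ , sb′) =
      let L₁ , sat₁ , adm₁ = antecedent-witness sa sa′
          L₂ , sat₂ , adm₂ = antecedent-witness sb sb′
      in L₁ ++ L₂ , [ sat₁ , sat₂ ]′ ∘ ∈-++⁻ L₁ ,
         λ adm → mem-closed y (∧-intro (hyp (adm₁ λ e → adm (∈-++⁺ˡ e)))
                                       (hyp (adm₂ λ e → adm (∈-++⁺ʳ L₁ e))))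
    antecedent-witness {y = y} (sa-∨ sa sb) (inj₁ sa′) =
      let L , sat , adm₁ = antecedent-witness sa sa′
      in L , sat , λ adm → mem-closed y (ax-∨₁ _ _ · hyp (adm₁ adm))
    antecedent-witness {y = y} (sa-∨ sa sb) (inj₂ sb′) =
      let L , sat , adm₂ = antecedent-witness sb sb′
      in L , sat , λ adm → mem-closed y (ax-∨₂ _ _ · hyp (adm₂ adm))

    -- If V p z fails, each listed □ⁿp is refuted by some □ⁿψ ∈ y with ψ ∉ z; the disjunction D
    -- of these ψ makes p ↦ D admissible although D ∉ z.
    ⋂V⊆V : ∀ {y Ls} → BoxedAtomsHold y Ls → ∀ {p z} → ⋂V (Admissible y Ls) p z → V p z
    ⋂V⊆V _ {p} {bomb} _ = V-bomb p
    ⋂V⊆V {y} {Ls} sat {p} {world Δ _} w = dne λ ¬Vz →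
      let D , □D∈y , D∉Δ = common-refutation {y} Δ p Ls λ {n} e → boxed-atom-refuted n (sat e) ¬Vz
      in D∉Δ (subst (Δ ∋_) (only-self p D) (w (only-admissible {y = y} Ls □D∈y)))

  sahlqvist-canonical : Λ φ → Sahlqvist φ → canonicalFrame ⊩ φ
  sahlqvist-canonical φ∈Λ (sahlqvist sa pc) val x y x⊑y yA =
    let Ls , sat , A-adm = antecedent-witness val sa yA
    in ⟦⟧-mono canonicalFrame (⋂V⊆V val sat) pc y
         (esakia (Admissible y Ls) (admissible-⊤ y Ls) (admissible-∧ {y} {Ls}) pc y
           λ {σ} adm → mem-closed y (ax-Λ _ φ∈Λ σ · hyp (A-adm adm)))

  canonical-complete : canonicalFrame ⊩ φ → Thm Λ φ
  canonical-complete {φ} valid = dne λ ⊬φ →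
    let Δ , _ , φ∉Δ = extend-avoiding ∅ φ (⊬φ ∘ ∅⊢⇒Thm)
    in φ∉Δ (truth⁻ φ (world Δ nothing) (valid canonicalValuation (world Δ nothing)))

theorem4p24 : LEM →
    (Λ : Fm → Set) →
    (∀ l → Λ l → Sahlqvist l) →
    (α : ∀ l → Λ l → FOSentence) →
    (∀ l (h : Λ l) (F : CKFrame) → ((F ⊩ l → F ⊨ α l h) × (F ⊨ α l h → F ⊩ l))) →
    (φ : Fm) →
    ((F : CKFrame) → (∀ l (h : Λ l) → F ⊨ α l h) → F ⊩ φ) →
    Thm Λ φ
theorem4p24 lem Λ Λ-sahlqvist α correspondence φ K-valid =
  canonical-complete (K-valid canonicalFrame canonical∈K)
  where
  open Canonical lem Λ
  canonical∈K : ∀ l (h : Λ l) → canonicalFrame ⊨ α l h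
  canonical∈K l h = proj₁ (correspondence l h canonicalFrame) (sahlqvist-canonical h (Λ-sahlqvist l h))
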